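{- Let $k\geq 1$ and let $G$ and $H$ be finite simple graphs with $\delta(G)+\delta(H)\geq k$. Then $\gamma_{\times k,t}(G\Box H)\geq k\,\rho(G)\,\rho(H)$.
   Context: All graphs are finite, undirected and simple; $\delta(G)$ denotes the minimum degree. For $k\geq 1$, a set $S\subseteq V(G)$ is a $k$-tuple total dominating set if every vertex $v$ has at least $k$ neighbors in $S$ (i.e. $|N(v)\cap S|\geq k$, $N(v)$ the open neighborhood); such a set exists iff $\delta(G)\geq k$, and then $\gamma_{\times k,t}(G)$ is the minimum cardinality of such a set. A packing is a set of vertices whose closed neighborhoods $N[v]=N(v)\cup\{v\}$ are pairwise disjoint; $\rho(G)$ is the maximum cardinality of a packing. The Cartesian product $G\Box H$ has vertex set $V(G)\times V(H)$, with $(u_1,v_1)$ adjacent to $(u_2,v_2)$ iff either $u_1=u_2$ and $v_1v_2\in E(H)$, or $v_1=v_2$ and $u_1u_2\in E(G)$; note $\delta(G\Box H)=\delta(G)+\delta(H)$. -}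

module Defs where

open import Data.Nat using (ℕ; zero; suc; _≤_; _⊓_)
open import Data.Bool using (Bool; true; false; _∧_; _∨_; if_then_else_)
open import Data.Fin using (Fin; zero; suc; _≟_; remQuot; combine)
open import Data.Fin.Subset using (Subset; _∈_; _∩_; ∣_∣; inside; outside)
open import Data.Vec using (tabulate)
open import Data.Product using (_×_; _,_; ∃)
open import Data.Empty using (⊥)
open import Relation.Nullary using (does; yes; no; ¬_)
open import Relation.Binary.PropositionalEquality using (_≡_; refl; _≢_)

record Graph : Set where
  field
    n      : ℕ
    adj    : Fin n → Fin n → Bool
    sym    : ∀ u v → adj u v ≡ adj v u
    irrefl : ∀ v → adj v v ≡ false
open Graph public

N : (G : Graph) → Fin (n G) → Subset (n G)
N G v = tabulate (λ u → adj G v u)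

N[_] : (G : Graph) → Fin (n G) → Subset (n G)
N[ G ] v = tabulate (λ u → adj G v u ∨ does (v ≟ u))

degree : (G : Graph) → Fin (n G) → ℕ
degree G v = ∣ N G v ∣

minOver : (m : ℕ) → (Fin (suc m) → ℕ) → ℕ
minOver zero    f = f zero
minOver (suc m) f = f zero ⊓ minOver m (λ i → f (suc i))

-- minimum degree δ(G); by convention 0 for the graph with no vertices
δ : Graph → ℕ
δ G with n G | degree G
... | zero  | _ = 0
... | suc m | d = minOver m d

-- Cartesian product G □ H on Fin (n G * n H), vertex (g , h) encoded as combine g h
private
  eqB : ∀ {m} → Fin m → Fin m → Bool
  eqB a b = does (a ≟ b)

  eqB-sym : ∀ {m} (a b : Fin m) → eqB a b ≡ eqB b a
  eqB-sym a b with a ≟ b | b ≟ a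
  ... | yes _ | yes _ = refl
  ... | no _  | no _  = refl
  ... | yes refl | no ¬p = Data.Empty.⊥-elim (¬p refl)
    where import Data.Empty
  ... | no ¬p | yes refl = Data.Empty.⊥-elim (¬p refl)
    where import Data.Empty

  eqB-refl : ∀ {m} (a : Fin m) → eqB a a ≡ true
  eqB-refl a with a ≟ a
  ... | yes _ = refl
  ... | no ¬p = Data.Empty.⊥-elim (¬p refl)
    where import Data.Empty

  prodAdj : (G H : Graph) → (a c : Fin (n G)) → (b d : Fin (n H)) → Bool
  prodAdj G H a c b d = (eqB a c ∧ adj H b d) ∨ (eqB b d ∧ adj G a c)

_□_ : Graph → Graph → Graph
G □ H = record
  { n      = n G Data.Nat.* n H
  ; adj    = λ x y → go (remQuot (n H) x) (remQuot (n H) y)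
  ; sym    = λ x y → goSym (remQuot (n H) x) (remQuot (n H) y)
  ; irrefl = λ x → goIrr (remQuot (n H) x)
  }
  where
    import Data.Nat
    go : Fin (n G) × Fin (n H) → Fin (n G) × Fin (n H) → Bool
    go (a , b) (c , d) = prodAdj G H a c b d
    goSym : ∀ p q → go p q ≡ go q p
    goSym (a , b) (c , d)
      rewrite eqB-sym a c | eqB-sym b d | sym G a c | sym H b d = refl
    goIrr : ∀ p → go p p ≡ false
    goIrr (a , b) rewrite eqB-refl a | eqB-refl b | irrefl G a | irrefl H b = refl

IsKTupleTotalDominating : (G : Graph) → ℕ → Subset (n G) → Set
IsKTupleTotalDominating G k S = ∀ v → k ≤ ∣ N G v ∩ S ∣

IsKTupleTotalDominationNumber : (G : Graph) → ℕ → ℕ → Set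
IsKTupleTotalDominationNumber G k g =
  (∃ λ S → IsKTupleTotalDominating G k S × ∣ S ∣ ≡ g)
  × (∀ S → IsKTupleTotalDominating G k S → g ≤ ∣ S ∣)

IsPacking : (G : Graph) → Subset (n G) → Set
IsPacking G P = ∀ u v → u ∈ P → v ∈ P → u ≢ v →
  ∀ w → w ∈ N[ G ] u → w ∈ N[ G ] v → ⊥

IsPackingNumber : (G : Graph) → ℕ → Set
IsPackingNumber G r =
  (∃ λ P → IsPacking G P × ∣ P ∣ ≡ r)
  × (∀ P → IsPacking G P → ∣ P ∣ ≤ r)

-- In G □ H the closed neighbourhood of (a , b) lies in N[a] × N[b], so the
-- product P × Q of packings of G and H is a packing of G □ H.  The open
-- neighbourhoods of the vertices of any packing are pairwise disjoint, and
-- each contains at least k vertices of a k-tuple total dominating set S;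
-- hence ∣ S ∣ ≥ k ∣ P ∣ ∣ Q ∣.
module Submission where

open import Defs hiding (sym)
open import Data.Bool using (true; false; _∧_; _∨_)
open import Data.Bool.Properties using (∨-zeroʳ)
open import Data.Empty using (⊥)
open import Data.Fin using (Fin; zero; suc; _≟_; remQuot; combine)
open import Data.Fin.Properties using (combine-remQuot; suc-injective)
open import Data.Fin.Subset using (Subset; _∈_; _⊆_; _∩_; _─_; ∣_∣; inside; outside)
  renaming (⊥ to ∅)
open import Data.Fin.Subset.Properties
  using (p⊆q⇒∣p∣≤∣q∣; x∈p∩q⁺; x∈p∩q⁻; x∈p∧x∉q⇒x∈p─q; ∣⊥∣≡0)
open import Data.Nat using (ℕ; suc; _≤_; z≤n; _+_; _*_)
open import Data.Nat.Properties
  using (≤-trans; +-mono-≤; +-suc; *-assoc; *-comm; module ≤-Reasoning)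
open import Data.Product using (_×_; _,_; proj₁; proj₂; uncurry)
open import Data.Product.Properties using (×-≡,≡→≡)
open import Data.Sum using (_⊎_; inj₁; inj₂)
open import Data.Vec using ([]; _∷_; here; there; _++_; lookup)
open import Data.Vec.Properties
  using ([]=⇒lookup; lookup⇒[]=; lookup∘tabulate; lookup-++ˡ; lookup-++ʳ; lookup-replicate)
open import Relation.Nullary using (Dec; yes; no; does)
open import Relation.Nullary.Decidable using (dec-true)
open import Relation.Binary.PropositionalEquality
  using (_≡_; _≢_; refl; sym; trans; cong; cong₂; module ≡-Reasoning)

private
  variable
    m k : ℕ

∣p∣≡∣q∩p∣+∣p─q∣ : (p q : Subset k) → ∣ p ∣ ≡ ∣ q ∩ p ∣ + ∣ p ─ q ∣
∣p∣≡∣q∩p∣+∣p─q∣ []            []            = refl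
∣p∣≡∣q∩p∣+∣p─q∣ (outside ∷ p) (inside  ∷ q) = ∣p∣≡∣q∩p∣+∣p─q∣ p q
∣p∣≡∣q∩p∣+∣p─q∣ (outside ∷ p) (outside ∷ q) = ∣p∣≡∣q∩p∣+∣p─q∣ p q
∣p∣≡∣q∩p∣+∣p─q∣ (inside  ∷ p) (inside  ∷ q) = cong suc (∣p∣≡∣q∩p∣+∣p─q∣ p q)
∣p∣≡∣q∩p∣+∣p─q∣ (inside  ∷ p) (outside ∷ q) =
  trans (cong suc (∣p∣≡∣q∩p∣+∣p─q∣ p q)) (sym (+-suc _ _))

∣p++q∣≡∣p∣+∣q∣ : (p : Subset m) (q : Subset k) → ∣ p ++ q ∣ ≡ ∣ p ∣ + ∣ q ∣
∣p++q∣≡∣p∣+∣q∣ []            q = refl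
∣p++q∣≡∣p∣+∣q∣ (inside  ∷ p) q = cong suc (∣p++q∣≡∣p∣+∣q∣ p q)
∣p++q∣≡∣p∣+∣q∣ (outside ∷ p) q = ∣p++q∣≡∣p∣+∣q∣ p q

disjoint-family-bound : (A : Fin m → Subset k) (P : Subset m) (S : Subset k) (c : ℕ) →
  (∀ {i} → i ∈ P → c ≤ ∣ A i ∩ S ∣) →
  (∀ {i j x} → i ∈ P → j ∈ P → i ≢ j → x ∈ A i → x ∈ A j → ⊥) →
  ∣ P ∣ * c ≤ ∣ S ∣
disjoint-family-bound A []            S c large disjoint = z≤n
disjoint-family-bound A (outside ∷ P) S c large disjoint =
  disjoint-family-bound (λ i → A (suc i)) P S c (λ i∈P → large (there i∈P))
    (λ i∈P j∈P i≢j → disjoint (there i∈P) (there j∈P) (λ si≡sj → i≢j (suc-injective si≡sj)))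
disjoint-family-bound A (inside ∷ P) S c large disjoint = begin
  c + ∣ P ∣ * c                 ≤⟨ +-mono-≤ (large here) rest ⟩
  ∣ A zero ∩ S ∣ + ∣ S ─ A zero ∣ ≡⟨ sym (∣p∣≡∣q∩p∣+∣p─q∣ S (A zero)) ⟩
  ∣ S ∣                         ∎
  where
  open ≤-Reasoning
  avoids-A₀ : ∀ {i} → i ∈ P → A (suc i) ∩ S ⊆ A (suc i) ∩ (S ─ A zero)
  avoids-A₀ i∈P x∈ with x∈p∩q⁻ _ _ x∈
  ... | x∈Ai , x∈S = x∈p∩q⁺ (x∈Ai , x∈p∧x∉q⇒x∈p─q x∈S
                       (λ x∈A₀ → disjoint here (there i∈P) (λ ()) x∈A₀ x∈Ai))
  rest : ∣ P ∣ * c ≤ ∣ S ─ A zero ∣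
  rest = disjoint-family-bound (λ i → A (suc i)) P (S ─ A zero) c
    (λ i∈P → ≤-trans (large (there i∈P)) (p⊆q⇒∣p∣≤∣q∣ (avoids-A₀ i∈P)))
    (λ i∈P j∈P i≢j → disjoint (there i∈P) (there j∈P) (λ si≡sj → i≢j (suc-injective si≡sj)))

_⊠_ : Subset m → Subset k → Subset (m * k)
[]            ⊠ q = []
(inside  ∷ p) ⊠ q = q ++ (p ⊠ q)
(outside ∷ p) ⊠ q = ∅ ++ (p ⊠ q)

∣p⊠q∣≡∣p∣*∣q∣ : (p : Subset m) (q : Subset k) → ∣ p ⊠ q ∣ ≡ ∣ p ∣ * ∣ q ∣
∣p⊠q∣≡∣p∣*∣q∣ []            q = refl
∣p⊠q∣≡∣p∣*∣q∣ (inside  ∷ p) q =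
  trans (∣p++q∣≡∣p∣+∣q∣ q (p ⊠ q)) (cong (∣ q ∣ +_) (∣p⊠q∣≡∣p∣*∣q∣ p q))
∣p⊠q∣≡∣p∣*∣q∣ {k = k} (outside ∷ p) q =
  trans (∣p++q∣≡∣p∣+∣q∣ (∅ {k}) (p ⊠ q)) (cong₂ _+_ (∣⊥∣≡0 k) (∣p⊠q∣≡∣p∣*∣q∣ p q))

lookup-⊠ : (p : Subset m) (q : Subset k) (a : Fin m) (b : Fin k) →
           lookup (p ⊠ q) (combine a b) ≡ lookup p a ∧ lookup q b
lookup-⊠ (inside  ∷ p) q zero b = lookup-++ˡ q (p ⊠ q) b
lookup-⊠ {k = k} (outside ∷ p) q zero b =
  trans (lookup-++ˡ (∅ {k}) (p ⊠ q) b) (lookup-replicate b false)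
lookup-⊠ (inside  ∷ p) q (suc a) b =
  trans (lookup-++ʳ q (p ⊠ q) (combine a b)) (lookup-⊠ p q a b)
lookup-⊠ {k = k} (outside ∷ p) q (suc a) b =
  trans (lookup-++ʳ (∅ {k}) (p ⊠ q) (combine a b)) (lookup-⊠ p q a b)

∧≡true⁻ : ∀ x y → x ∧ y ≡ true → x ≡ true × y ≡ true
∧≡true⁻ true true refl = refl , refl

∈-⊠⁻ : (p : Subset m) (q : Subset k) {x : Fin (m * k)} → x ∈ p ⊠ q →
       proj₁ (remQuot {m} k x) ∈ p × proj₂ (remQuot {m} k x) ∈ q
∈-⊠⁻ {m} {k} p q {x} x∈ with ∧≡true⁻ _ _ (begin
    lookup p a ∧ lookup q b              ≡⟨ lookup-⊠ p q a b ⟨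
    lookup (p ⊠ q) (combine a b)         ≡⟨ cong (lookup (p ⊠ q)) (combine-remQuot {m} k x) ⟩
    lookup (p ⊠ q) x                     ≡⟨ []=⇒lookup x∈ ⟩
    true                                 ∎)
  where
  open ≡-Reasoning
  a = proj₁ (remQuot {m} k x)
  b = proj₂ (remQuot {m} k x)
... | a∈p , b∈q = lookup⇒[]= _ p a∈p , lookup⇒[]= _ q b∈q

remQuot-injective : ∀ k {x y : Fin (m * k)} → remQuot {m} k x ≡ remQuot k y → x ≡ y
remQuot-injective {m} k {x} {y} eq = begin
  x                                 ≡⟨ combine-remQuot {m} k x ⟨
  uncurry combine (remQuot {m} k x) ≡⟨ cong (uncurry combine) eq ⟩
  uncurry combine (remQuot {m} k y) ≡⟨ combine-remQuot {m} k y ⟩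
  y                                 ∎
  where open ≡-Reasoning

∨-does⁻ : ∀ {A : Set} x (a? : Dec A) → x ∨ does a? ≡ true → x ≡ true ⊎ A
∨-does⁻ true  _       _ = inj₁ refl
∨-does⁻ false (yes a) _ = inj₂ a

-- The shape of the adjacency relation of G □ H.
∧-does-∨-∧-does⁻ : ∀ {A B : Set} (a? : Dec A) x (b? : Dec B) y →
  (does a? ∧ x) ∨ (does b? ∧ y) ≡ true → (A × x ≡ true) ⊎ (B × y ≡ true)
∧-does-∨-∧-does⁻ (yes a) true  _       _     _  = inj₁ (a , refl)
∧-does-∨-∧-does⁻ _       _     (yes b) true  _  = inj₂ (b , refl)
∧-does-∨-∧-does⁻ (yes _) false (yes _) false ()
∧-does-∨-∧-does⁻ (yes _) false (no _)  _     ()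
∧-does-∨-∧-does⁻ (no _)  _     (yes _) false ()
∧-does-∨-∧-does⁻ (no _)  _     (no _)  _     ()

module _ (G : Graph) where

  ∈N⁻ : ∀ {v w} → w ∈ N G v → adj G v w ≡ true
  ∈N⁻ {v} {w} w∈ = trans (sym (lookup∘tabulate (adj G v) w)) ([]=⇒lookup w∈)

  ∈N[]⁻ : ∀ {v w} → w ∈ N[ G ] v → adj G v w ≡ true ⊎ v ≡ w
  ∈N[]⁻ {v} {w} w∈ = ∨-does⁻ (adj G v w) (v ≟ w)
    (trans (sym (lookup∘tabulate (λ u → adj G v u ∨ does (v ≟ u)) w)) ([]=⇒lookup w∈))

  ∈N[]⁺ : ∀ {v w} → adj G v w ≡ true ⊎ v ≡ w → w ∈ N[ G ] v
  ∈N[]⁺ {v} {w} h = lookup⇒[]= w (N[ G ] v)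
    (trans (lookup∘tabulate (λ u → adj G v u ∨ does (v ≟ u)) w) (adj∨≡ h))
    where
    adj∨≡ : adj G v w ≡ true ⊎ v ≡ w → adj G v w ∨ does (v ≟ w) ≡ true
    adj∨≡ (inj₁ vw) = cong (_∨ does (v ≟ w)) vw
    adj∨≡ (inj₂ v≡w) = trans (cong (adj G v w ∨_) (dec-true (v ≟ w) v≡w)) (∨-zeroʳ _)

  N⊆N[] : ∀ v → N G v ⊆ N[ G ] v
  N⊆N[] v w∈ = ∈N[]⁺ (inj₁ (∈N⁻ w∈))

  packing⇒∣P∣*k≤∣S∣ : ∀ {k S P} → IsKTupleTotalDominating G k S → IsPacking G P →
                      ∣ P ∣ * k ≤ ∣ S ∣
  packing⇒∣P∣*k≤∣S∣ {k} {S} {P} dom packing =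
    disjoint-family-bound (N G) P S k (λ {v} _ → dom v)
    (λ {i} {j} i∈P j∈P i≢j x∈Ni x∈Nj →
      packing i j i∈P j∈P i≢j _ (N⊆N[] i x∈Ni) (N⊆N[] j x∈Nj))

module _ (G H : Graph) where

  coords : Fin (n (G □ H)) → Fin (n G) × Fin (n H)
  coords = remQuot (n H)

  ∈N[□]⁻ : ∀ {x w} → w ∈ N[ G □ H ] x →
           proj₁ (coords w) ∈ N[ G ] (proj₁ (coords x)) ×
           proj₂ (coords w) ∈ N[ H ] (proj₂ (coords x))
  ∈N[□]⁻ {x} {w} w∈ with ∈N[]⁻ (G □ H) w∈
  ... | inj₂ refl = ∈N[]⁺ G (inj₂ refl) , ∈N[]⁺ H (inj₂ refl)
  ... | inj₁ xw
    with ∧-does-∨-∧-does⁻ (proj₁ (coords x) ≟ proj₁ (coords w)) _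
                           (proj₂ (coords x) ≟ proj₂ (coords w)) _ xw
  ... | inj₁ (a≡c , bd) = ∈N[]⁺ G (inj₂ a≡c) , ∈N[]⁺ H (inj₁ bd)
  ... | inj₂ (b≡d , ac) = ∈N[]⁺ G (inj₁ ac) , ∈N[]⁺ H (inj₂ b≡d)

  ⊠-packing : ∀ {P Q} → IsPacking G P → IsPacking H Q → IsPacking (G □ H) (P ⊠ Q)
  ⊠-packing {P} {Q} packingP packingQ x y x∈ y∈ x≢y w w∈Nx w∈Ny
    with proj₁ (coords x) ≟ proj₁ (coords y)
  ... | no a≢c = packingP _ _ (proj₁ (∈-⊠⁻ P Q x∈)) (proj₁ (∈-⊠⁻ P Q y∈)) a≢c _
                   (proj₁ (∈N[□]⁻ w∈Nx)) (proj₁ (∈N[□]⁻ w∈Ny))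
  ... | yes a≡c = packingQ _ _ (proj₂ (∈-⊠⁻ P Q x∈)) (proj₂ (∈-⊠⁻ P Q y∈))
                   (λ b≡d → x≢y (remQuot-injective (n H) (×-≡,≡→≡ (a≡c , b≡d)))) _
                   (proj₂ (∈N[□]⁻ w∈Nx)) (proj₂ (∈N[□]⁻ w∈Ny))

theorem2 : (k : ℕ) → 1 ≤ k → (G H : Graph) → k ≤ δ G + δ H →
    (g rG rH : ℕ) →
    IsKTupleTotalDominationNumber (G □ H) k g →
    IsPackingNumber G rG → IsPackingNumber H rH →
    k * rG * rH ≤ g
theorem2 k _ G H _ _ _ _
  ((S , dom , refl) , _) ((P , packingP , refl) , _) ((Q , packingQ , refl) , _) =
  begin
    k * ∣ P ∣ * ∣ Q ∣   ≡⟨ trans (*-assoc k ∣ P ∣ ∣ Q ∣) (*-comm k _) ⟩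
    ∣ P ∣ * ∣ Q ∣ * k   ≡⟨ cong (_* k) (∣p⊠q∣≡∣p∣*∣q∣ P Q) ⟨
    ∣ P ⊠ Q ∣ * k       ≤⟨ packing⇒∣P∣*k≤∣S∣ (G □ H) dom (⊠-packing G H packingP packingQ) ⟩
    ∣ S ∣               ∎
  where open ≤-Reasoning
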